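{- Let $a_1,\dots,a_4,p_1,\dots,p_4,x_1,\dots,x_4,q_1,\dots,q_4$ be nonzero complex numbers. Put $K:=a_1a_2a_3a_4$, $L:=(p_1p_2p_3p_4)^{1/2}$, $K_0:=x_1x_2x_3x_4$, $L_0:=(q_1q_2q_3q_4)^{1/2}$, and for an integer $k\ge-1$ $$D_k[\bar x;\bar q]:=x_1x_2(q_1q_2)^{k/2}-x_3x_4(q_3q_4)^{k/2},\qquad D_k[\bar a;\bar p]:=a_1a_2(p_1p_2)^{k/2}-a_3a_4(p_3p_4)^{k/2}.$$ Then for every integer $n\ge0$ (whenever no denominator vanishes) $$\frac{a_1}{a_2}\sum_{k=0}^{n-1}D_{k-1}[\bar a;\bar p]\Big(\frac{p_1}{p_2}\Big)^{(k-1)/2}\frac{(a_1^2/p_1;p_1)_k(x_1^2;q_1)_k}{(Kp_2/(La_2^2);L/p_2)_{k+1}(K_0/x_2^2;L_0/q_2)_k}$$ $$=1-\frac{(a_1^2/p_1;p_1)_n(x_1^2;q_1)_n}{(Kp_2/(La_2^2);L/p_2)_n(K_0/x_2^2;L_0/q_2)_n}-\frac{x_1}{x_2}\sum_{k=0}^{n-1}D_k[\bar x;\bar q]\Big(\frac{q_1}{q_2}\Big)^{k/2}\frac{(a_1^2/p_1;p_1)_{k+1}(x_1^2;q_1)_k}{(Kp_2/(La_2^2);L/p_2)_{k+1}(K_0/x_2^2;L_0/q_2)_{k+1}}.$$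
   Context: For a complex number $z$, a nonzero complex base $p$ and an integer $k\ge0$, $(z;p)_k:=\prod_{j=0}^{k-1}(1-zp^j)$. Square roots $p_i^{1/2},q_i^{1/2}$ are fixed, and every half-integer power of a product or quotient of the $p_i$ (resp. $q_i$) is understood as the corresponding product of powers of these fixed roots. -}

module Defs where

open import Level using (Level; _⊔_) renaming (suc to lsuc)
open import Algebra.Bundles using (CommutativeRing)
open import Data.Nat using (ℕ; zero; suc)
open import Data.Integer using (ℤ; +_; -[1+_])
open import Data.Fin using (Fin; zero; suc)
open import Relation.Nullary using (¬_)

-- A field: a commutative ring with 0 ≉ 1 and a (total) inverse map that is a
-- two-sided inverse on nonzero elements.  (Used in place of ℂ, which the
-- standard library lacks.)
record Field (c ℓ : Level) : Set (lsuc (c ⊔ ℓ)) where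
  field
    commutativeRing : CommutativeRing c ℓ
  open CommutativeRing commutativeRing public
  field
    _⁻¹     : Carrier → Carrier
    inverse : ∀ x → ¬ (x ≈ 0#) → x * (x ⁻¹) ≈ 1#
    0≉1     : ¬ (0# ≈ 1#)

i1 i2 i3 i4 : Fin 4
i1 = zero
i2 = suc zero
i3 = suc (suc zero)
i4 = suc (suc (suc zero))

module FieldOps {c ℓ : Level} (F : Field c ℓ) where
  open Field F

  infixl 6 _–_
  infixl 7 _/_

  _–_ : Carrier → Carrier → Carrier
  x – y = x + (- y)

  _/_ : Carrier → Carrier → Carrier
  x / y = x * (y ⁻¹)

  pow : Carrier → ℕ → Carrier
  pow x zero    = 1#
  pow x (suc k) = pow x k * x

  powℤ : Carrier → ℤ → Carrier
  powℤ x (+ k)      = pow x k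
  powℤ x -[1+ k ]   = (pow x (suc k)) ⁻¹

  poch : Carrier → Carrier → ℕ → Carrier
  poch z p zero    = 1#
  poch z p (suc k) = poch z p k * (1# – z * pow p k)

  sumTo : ℕ → (ℕ → Carrier) → Carrier
  sumTo zero    f = 0#
  sumTo (suc n) f = sumTo n f + f n

  -- D_k[ā;p̄] = a1 a2 (p1 p2)^{k/2} - a3 a4 (p3 p4)^{k/2}, where
  -- (p1p2)^{k/2} := (p1^{1/2} p2^{1/2})^k with the fixed roots s i = p_i^{1/2}
  D : (Fin 4 → Carrier) → (Fin 4 → Carrier) → ℤ → Carrier
  D a s k = a i1 * a i2 * powℤ (s i1 * s i2) k – a i3 * a i4 * powℤ (s i3 * s i4) k

-- Write Tₖ = AₖXₖ/(BₖYₖ) for the ratio of q-Pochhammer symbols in the statement.  Passing from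
-- k to k + 1 multiplies A, X, B, Y by 1 − αₖ, 1 − ξₖ, 1 − βₖ, 1 − ηₖ, and the two coefficients are
-- differences of these: (a₁/a₂) D_{k−1}[ā;p̄] (p₁/p₂)^{(k−1)/2} = αₖ − βₖ and
-- (x₁/x₂) D_k[x̄;q̄] (q₁/q₂)^{k/2} = ξₖ − ηₖ.  Hence the k-th terms of the two sums differ by
-- exactly Tₖ − Tₖ₊₁, and the identity telescopes to 1 − Tₙ because T₀ = 1.
module Submission where

open import Defs
open import Level using (Level)
open import Algebra.Bundles using (CommutativeRing)
open import Data.Fin using (Fin)
open import Data.Integer as ℤ using (ℤ; +_; -[1+_]; sign; ∣_∣; _◃_; _⊖_) renaming (_-_ to _-ℤ_)
import Data.Integer.Properties as ℤ
open import Data.Maybe using (Maybe; just; nothing)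
open import Data.Nat as ℕ using (ℕ; zero; suc; _<_; _≤′_; ≤′-refl; ≤′-step)
import Data.Nat.Properties as ℕ
open import Data.Sign as Sign using (Sign)
open import Function using (_∘_)
open import Relation.Nullary using (¬_; yes; no)
open import Relation.Binary.PropositionalEquality using (cong) renaming (refl to ≡-refl)
import Algebra.Solver.Ring
import Algebra.Solver.Ring.AlmostCommutativeRing as AlmostCommutativeRing

-- The ring solver normalises polynomials with coefficients in ℤ; cancellation such as
-- x − x ≈ 0 needs decidable equality of coefficients, which a general carrier lacks.
module IntegerCoefficientSolver {c ℓ : Level} (R : CommutativeRing c ℓ) where
  open CommutativeRing R
  open import Algebra.Properties.Semiring.Mult.TCOptimised semiring using (_×_; 1+×; ×-homo-+; ×1-homo-*)
  open import Algebra.Properties.Ring ring using (-1*x≈-x)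
  open import Algebra.Properties.AbelianGroup +-abelianGroup using (⁻¹-∙-comm; ε⁻¹≈ε; ⁻¹-involutive)
  open import Algebra.Properties.CommutativeSemigroup +-commutativeSemigroup using (x∙yz≈y∙xz)
  open import Algebra.Properties.CommutativeSemigroup *-commutativeSemigroup using (interchange)
  open import Relation.Binary.Reasoning.Setoid setoid

  ⟦_⟧ : ℤ → Carrier
  ⟦ + n ⟧      = n × 1#
  ⟦ -[1+ n ] ⟧ = - (suc n × 1#)

  ⟦_⟧ₛ : Sign → Carrier
  ⟦ Sign.+ ⟧ₛ = 1#
  ⟦ Sign.- ⟧ₛ = - 1#

  ⟦-+⟧ : ∀ n → ⟦ ℤ.- (+ n) ⟧ ≈ - (n × 1#)
  ⟦-+⟧ zero    = sym ε⁻¹≈ε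
  ⟦-+⟧ (suc n) = refl

  1+x-[1+y]≈x-y : ∀ x y → (1# + x) - (1# + y) ≈ x - y
  1+x-[1+y]≈x-y x y = begin
    (1# + x) + - (1# + y)     ≈⟨ +-congˡ (⁻¹-∙-comm 1# y) ⟨
    (1# + x) + (- 1# + - y)   ≈⟨ +-assoc 1# x _ ⟩
    1# + (x + (- 1# + - y))   ≈⟨ +-congˡ (x∙yz≈y∙xz x (- 1#) (- y)) ⟩
    1# + (- 1# + (x - y))     ≈⟨ +-assoc 1# (- 1#) _ ⟨
    (1# - 1#) + (x - y)       ≈⟨ +-congʳ (-‿inverseʳ 1#) ⟩
    0# + (x - y)              ≈⟨ +-identityˡ _ ⟩
    x - y                     ∎

  ⟦⊖⟧ : ∀ m n → ⟦ m ⊖ n ⟧ ≈ m × 1# - n × 1#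
  ⟦⊖⟧ m       zero    = sym (trans (+-congˡ ε⁻¹≈ε) (+-identityʳ _))
  ⟦⊖⟧ zero    (suc n) = sym (+-identityˡ _)
  ⟦⊖⟧ (suc m) (suc n) rewrite ℤ.[1+m]⊖[1+n]≡m⊖n m n =
    trans (⟦⊖⟧ m n) (sym (trans (+-cong (1+× m 1#) (-‿cong (1+× n 1#))) (1+x-[1+y]≈x-y (m × 1#) (n × 1#))))

  +-homo : ∀ i j → ⟦ i ℤ.+ j ⟧ ≈ ⟦ i ⟧ + ⟦ j ⟧
  +-homo (+ m)    (+ n)    = ×-homo-+ 1# m n
  +-homo (+ m)    -[1+ n ] = ⟦⊖⟧ m (suc n)
  +-homo -[1+ m ] (+ n)    = trans (⟦⊖⟧ n (suc m)) (+-comm _ _)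
  +-homo -[1+ m ] -[1+ n ] = begin
    - (suc (suc (m ℕ.+ n)) × 1#)        ≡⟨ cong (λ k → - (suc k × 1#)) (ℕ.+-suc m n) ⟨
    - ((suc m ℕ.+ suc n) × 1#)          ≈⟨ -‿cong (×-homo-+ 1# (suc m) (suc n)) ⟩
    - (suc m × 1# + suc n × 1#)         ≈⟨ ⁻¹-∙-comm _ _ ⟨
    - (suc m × 1#) + - (suc n × 1#)     ∎

  ⟦⟧≈⟦sign⟧*∣∣ : ∀ i → ⟦ i ⟧ ≈ ⟦ sign i ⟧ₛ * (∣ i ∣ × 1#)
  ⟦⟧≈⟦sign⟧*∣∣ (+ n)    = sym (*-identityˡ _)
  ⟦⟧≈⟦sign⟧*∣∣ -[1+ n ] = sym (-1*x≈-x _)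

  ⟦◃⟧ : ∀ s n → ⟦ s ◃ n ⟧ ≈ ⟦ s ⟧ₛ * (n × 1#)
  ⟦◃⟧ s      zero    = sym (zeroʳ _)
  ⟦◃⟧ Sign.+ (suc n) = sym (*-identityˡ _)
  ⟦◃⟧ Sign.- (suc n) = sym (-1*x≈-x _)

  ⟦*⟧ₛ : ∀ s t → ⟦ s Sign.* t ⟧ₛ ≈ ⟦ s ⟧ₛ * ⟦ t ⟧ₛ
  ⟦*⟧ₛ Sign.+ t      = sym (*-identityˡ _)
  ⟦*⟧ₛ Sign.- Sign.+ = sym (*-identityʳ _)
  ⟦*⟧ₛ Sign.- Sign.- = sym (trans (-1*x≈-x (- 1#)) (⁻¹-involutive 1#))

  *-homo : ∀ i j → ⟦ i ℤ.* j ⟧ ≈ ⟦ i ⟧ * ⟦ j ⟧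
  *-homo i j = begin
    ⟦ sign i Sign.* sign j ◃ ∣ i ∣ ℕ.* ∣ j ∣ ⟧
      ≈⟨ ⟦◃⟧ (sign i Sign.* sign j) (∣ i ∣ ℕ.* ∣ j ∣) ⟩
    ⟦ sign i Sign.* sign j ⟧ₛ * ((∣ i ∣ ℕ.* ∣ j ∣) × 1#)
      ≈⟨ *-cong (⟦*⟧ₛ (sign i) (sign j)) (×1-homo-* ∣ i ∣ ∣ j ∣) ⟩
    (⟦ sign i ⟧ₛ * ⟦ sign j ⟧ₛ) * ((∣ i ∣ × 1#) * (∣ j ∣ × 1#))
      ≈⟨ interchange _ _ _ _ ⟩
    (⟦ sign i ⟧ₛ * (∣ i ∣ × 1#)) * (⟦ sign j ⟧ₛ * (∣ j ∣ × 1#))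
      ≈⟨ *-cong (⟦⟧≈⟦sign⟧*∣∣ i) (⟦⟧≈⟦sign⟧*∣∣ j) ⟨
    ⟦ i ⟧ * ⟦ j ⟧
      ∎

  -‿homo : ∀ i → ⟦ ℤ.- i ⟧ ≈ - ⟦ i ⟧
  -‿homo (+ n)    = ⟦-+⟧ n
  -‿homo -[1+ n ] = sym (⁻¹-involutive _)

  homomorphism : ℤ.+-*-rawRing AlmostCommutativeRing.-Raw-AlmostCommutative⟶
                 AlmostCommutativeRing.fromCommutativeRing R
  homomorphism = record
    { ⟦_⟧ = ⟦_⟧ ; +-homo = +-homo ; *-homo = *-homo ; -‿homo = -‿homo
    ; 0-homo = refl ; 1-homo = refl }

  equal? : ∀ i j → Maybe (⟦ i ⟧ ≈ ⟦ j ⟧)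
  equal? i j with i ℤ.≟ j
  ... | yes ≡-refl = just refl
  ... | no _       = nothing

  open Algebra.Solver.Ring ℤ.+-*-rawRing (AlmostCommutativeRing.fromCommutativeRing R) homomorphism equal?
    public using (solve; _:=_; _:+_; _:*_; _:-_; con)

module FieldProperties {c ℓ : Level} (F : Field c ℓ) where
  open Field F
  open FieldOps F
  open import Algebra.Properties.CommutativeSemigroup *-commutativeSemigroup using (x∙yz≈y∙xz; interchange)
  open import Relation.Binary.Reasoning.Setoid setoid

  1≉0 : 1# ≉ 0#
  1≉0 = 0≉1 ∘ sym

  x*y≉0⇒x≉0 : ∀ {x y} → x * y ≉ 0# → x ≉ 0#
  x*y≉0⇒x≉0 {y = y} xy≉0 x≈0 = xy≉0 (trans (*-congʳ x≈0) (zeroˡ y))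

  x*y≉0⇒y≉0 : ∀ {x y} → x * y ≉ 0# → y ≉ 0#
  x*y≉0⇒y≉0 {x} xy≉0 y≈0 = xy≉0 (trans (*-congˡ y≈0) (zeroʳ x))

  x*x≈y≉0⇒x≉0 : ∀ {x y} → x * x ≈ y → y ≉ 0# → x ≉ 0#
  x*x≈y≉0⇒x≉0 x*x≈y y≉0 = x*y≉0⇒x≉0 (y≉0 ∘ trans (sym x*x≈y))

  x*y≈1⇒x≉0 : ∀ {x y} → x * y ≈ 1# → x ≉ 0#
  x*y≈1⇒x≉0 {y = y} xy≈1 x≈0 = 0≉1 (trans (sym (trans (*-congʳ x≈0) (zeroˡ y))) xy≈1)

  ⁻¹-unique : ∀ {x y} → x * y ≈ 1# → x ⁻¹ ≈ y
  ⁻¹-unique {x} {y} xy≈1 = begin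
    x ⁻¹              ≈⟨ *-identityʳ _ ⟨
    x ⁻¹ * 1#         ≈⟨ *-congˡ xy≈1 ⟨
    x ⁻¹ * (x * y)    ≈⟨ x∙yz≈y∙xz (x ⁻¹) x y ⟩
    x * (x ⁻¹ * y)    ≈⟨ *-assoc x (x ⁻¹) y ⟨
    x * x ⁻¹ * y      ≈⟨ *-congʳ (inverse x (x*y≈1⇒x≉0 xy≈1)) ⟩
    1# * y            ≈⟨ *-identityˡ y ⟩
    y                 ∎

  x≉0⇒x⁻¹≉0 : ∀ {x} → x ≉ 0# → x ⁻¹ ≉ 0#
  x≉0⇒x⁻¹≉0 {x} x≉0 = x*y≈1⇒x≉0 (trans (*-comm (x ⁻¹) x) (inverse x x≉0))

  inverse-* : ∀ {x x′ y y′} → x * x′ ≈ 1# → y * y′ ≈ 1# → x * y * (x′ * y′) ≈ 1#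
  inverse-* {x} {x′} {y} {y′} xx′≈1 yy′≈1 = begin
    x * y * (x′ * y′)    ≈⟨ interchange x y x′ y′ ⟩
    x * x′ * (y * y′)    ≈⟨ *-cong xx′≈1 yy′≈1 ⟩
    1# * 1#              ≈⟨ *-identityˡ 1# ⟩
    1#                   ∎

  x≉0∧y≉0⇒x*y≉0 : ∀ {x y} → x ≉ 0# → y ≉ 0# → x * y ≉ 0#
  x≉0∧y≉0⇒x*y≉0 {x} {y} x≉0 y≉0 = x*y≈1⇒x≉0 (inverse-* (inverse x x≉0) (inverse y y≉0))

  ⁻¹-distrib-* : ∀ {x y} → x ≉ 0# → y ≉ 0# → (x * y) ⁻¹ ≈ x ⁻¹ * y ⁻¹
  ⁻¹-distrib-* {x} {y} x≉0 y≉0 = ⁻¹-unique (inverse-* (inverse x x≉0) (inverse y y≉0))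

  ⁻¹-involutive : ∀ {x} → x ≉ 0# → x ⁻¹ ⁻¹ ≈ x
  ⁻¹-involutive {x} x≉0 = ⁻¹-unique (trans (*-comm (x ⁻¹) x) (inverse x x≉0))

  -- The field record only makes _⁻¹ a congruence at nonzero elements.
  ⁻¹-cong : ∀ {x y} → x ≈ y → y ≉ 0# → x ⁻¹ ≈ y ⁻¹
  ⁻¹-cong {y = y} x≈y y≉0 = ⁻¹-unique (trans (*-congʳ x≈y) (inverse y y≉0))

  pow-cong : ∀ {x y} m → x ≈ y → pow x m ≈ pow y m
  pow-cong zero    x≈y = refl
  pow-cong (suc m) x≈y = *-cong (pow-cong m x≈y) x≈y

  pow-distrib-* : ∀ x y m → pow (x * y) m ≈ pow x m * pow y m
  pow-distrib-* x y zero    = sym (*-identityˡ 1#)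
  pow-distrib-* x y (suc m) = trans (*-congʳ (pow-distrib-* x y m)) (interchange _ _ x y)

  pow-1# : ∀ m → pow 1# m ≈ 1#
  pow-1# zero    = refl
  pow-1# (suc m) = trans (*-identityʳ _) (pow-1# m)

  pow≉0 : ∀ {x} m → x ≉ 0# → pow x m ≉ 0#
  pow≉0 zero    x≉0 = 1≉0
  pow≉0 (suc m) x≉0 = x≉0∧y≉0⇒x*y≉0 (pow≉0 m x≉0) x≉0

  powℤ-cong : ∀ {x y} → x ≈ y → y ≉ 0# → ∀ e → powℤ x e ≈ powℤ y e
  powℤ-cong x≈y y≉0 (+ m)    = pow-cong m x≈y
  powℤ-cong x≈y y≉0 -[1+ m ] = ⁻¹-cong (pow-cong (suc m) x≈y) (pow≉0 (suc m) y≉0)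

  powℤ-distrib-* : ∀ {x y} → x ≉ 0# → y ≉ 0# → ∀ e → powℤ (x * y) e ≈ powℤ x e * powℤ y e
  powℤ-distrib-* {x} {y} x≉0 y≉0 (+ m)    = pow-distrib-* x y m
  powℤ-distrib-* {x} {y} x≉0 y≉0 -[1+ m ] = begin
    pow (x * y) (suc m) ⁻¹                  ≈⟨ ⁻¹-cong (pow-distrib-* x y (suc m)) (x≉0∧y≉0⇒x*y≉0 xᵐ≉0 yᵐ≉0) ⟩
    (pow x (suc m) * pow y (suc m)) ⁻¹      ≈⟨ ⁻¹-distrib-* xᵐ≉0 yᵐ≉0 ⟩
    pow x (suc m) ⁻¹ * pow y (suc m) ⁻¹     ∎
    where
    xᵐ≉0 : pow x (suc m) ≉ 0#
    xᵐ≉0 = pow≉0 (suc m) x≉0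
    yᵐ≉0 : pow y (suc m) ≉ 0#
    yᵐ≉0 = pow≉0 (suc m) y≉0

  powℤ-1# : ∀ e → powℤ 1# e ≈ 1#
  powℤ-1# (+ m)    = pow-1# m
  powℤ-1# -[1+ m ] = ⁻¹-unique (trans (*-identityʳ _) (pow-1# (suc m)))

  powℤ-pred : ∀ {x} → x ≉ 0# → ∀ k → x ⁻¹ * pow x k ≈ powℤ x (+ k -ℤ + 1)
  powℤ-pred {x} x≉0 zero    = trans (*-identityʳ (x ⁻¹)) (sym (⁻¹-cong (*-identityˡ x) x≉0))
  powℤ-pred {x} x≉0 (suc k) = begin
    x ⁻¹ * (pow x k * x)    ≈⟨ x∙yz≈y∙xz (x ⁻¹) (pow x k) x ⟩
    pow x k * (x ⁻¹ * x)    ≈⟨ *-congˡ (trans (*-comm (x ⁻¹) x) (inverse x x≉0)) ⟩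
    pow x k * 1#            ≈⟨ *-identityʳ _ ⟩
    pow x k                 ∎

module PochhammerTelescoping {c ℓ : Level} (F : Field c ℓ) where
  open Field F
  open FieldOps F
  open FieldProperties F
  open IntegerCoefficientSolver commutativeRing
  open import Relation.Binary.Reasoning.Setoid setoid

  poch≉0-mono : ∀ {z p m n} → m ≤′ n → poch z p n ≉ 0# → poch z p m ≉ 0#
  poch≉0-mono ≤′-refl        pochₙ≉0 = pochₙ≉0
  poch≉0-mono (≤′-step m≤′n) pochₙ≉0 = poch≉0-mono m≤′n (x*y≉0⇒x≉0 pochₙ≉0)

  sumTo-telescope : ∀ {r r′ : Carrier} {f g t : ℕ → Carrier} n →
    (∀ k → k < n → r * f k ≈ t k – t (suc k) – r′ * g k) →
    r * sumTo n f ≈ t 0 – t n – r′ * sumTo n g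
  sumTo-telescope {r} {r′} {t = t} zero _ = empty r r′ (t 0)
    where
    empty : ∀ r r′ t₀ → r * 0# ≈ t₀ – t₀ – r′ * 0#
    empty = solve 3 (λ r r′ t₀ → r :* con (+ 0) := t₀ :- t₀ :- r′ :* con (+ 0)) refl
  sumTo-telescope {r} {r′} {f} {g} {t} (suc n) step = begin
    r * (sumTo n f + f n)
      ≈⟨ distribˡ r _ _ ⟩
    r * sumTo n f + r * f n
      ≈⟨ +-cong (sumTo-telescope n (λ k k<n → step k (ℕ.m<n⇒m<1+n k<n))) (step n ℕ.≤-refl) ⟩
    (t 0 – t n – r′ * sumTo n g) + (t n – t (suc n) – r′ * g n)
      ≈⟨ cancel (t 0) (t n) (t (suc n)) r′ (sumTo n g) (g n) ⟩
    t 0 – t (suc n) – r′ * (sumTo n g + g n)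
      ∎
    where
    cancel : ∀ t₀ tₙ tₙ₊₁ r′ S G → (t₀ – tₙ – r′ * S) + (tₙ – tₙ₊₁ – r′ * G) ≈ t₀ – tₙ₊₁ – r′ * (S + G)
    cancel = solve 6 (λ t₀ tₙ tₙ₊₁ r′ S G →
      (t₀ :- tₙ :- r′ :* S) :+ (tₙ :- tₙ₊₁ :- r′ :* G) := t₀ :- tₙ₊₁ :- r′ :* (S :+ G)) refl

  -- Both sides equal (A X / (B Y)) (1 − (1 − α) / (1 − β)).
  pochhammer-step : ∀ {r c r′ c′ α β ξ η A X B Y} →
    r * c ≈ α – β → r′ * c′ ≈ ξ – η → B * (1# – β) ≉ 0# → Y * (1# – η) ≉ 0# →
    r * (c * (A * X) / (B * (1# – β) * Y))
      ≈ A * X / (B * Y) – A * (1# – α) * (X * (1# – ξ)) / (B * (1# – β) * (Y * (1# – η)))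
        – r′ * (c′ * (A * (1# – α) * X) / (B * (1# – β) * (Y * (1# – η))))
  pochhammer-step {r} {c} {r′} {c′} {α} {β} {ξ} {η} {A} {X} {B} {Y} rc≈α-β r′c′≈ξ-η B′≉0 Y′≉0 = begin
    r * (c * (A * X) * (B * (1# – β) * Y) ⁻¹)
      ≈⟨ *-congˡ (*-congˡ (⁻¹-distrib-* B′≉0 Y≉0)) ⟩
    r * (c * (A * X) * ((B * (1# – β)) ⁻¹ * Y ⁻¹))
      ≈⟨ *-congˡ (*-congˡ (*-congʳ (⁻¹-distrib-* B≉0 β̄≉0))) ⟩
    r * (c * (A * X) * (iB * iβ̄ * iY))
      ≈⟨ regroup r c A X iB iβ̄ iY ⟩
    r * c * iβ̄ * u
      ≈⟨ *-congʳ (*-congʳ rc≈α-β) ⟩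
    (α – β) * iβ̄ * u
      ≈⟨ difference α β iβ̄ u ⟩
    ((1# – β) * iβ̄ – (1# – α) * iβ̄) * u
      ≈⟨ *-congʳ (+-congʳ (inverse (1# – β) β̄≉0)) ⟩
    (1# – (1# – α) * iβ̄) * u
      ≈⟨ *-congʳ (+-congˡ (-‿cong (trans (*-congˡ (inverse (1# – η) η̄≉0)) (*-identityʳ _)))) ⟨
    (1# – (1# – α) * iβ̄ * ((1# – η) * iη̄)) * u
      ≈⟨ expand α ξ η A X iB iβ̄ iY iη̄ ⟩
    A * X * (iB * iY) – A * (1# – α) * (X * (1# – ξ)) * I – (ξ – η) * (A * (1# – α) * X * I)
      ≈⟨ +-congˡ (-‿cong (*-congʳ r′c′≈ξ-η)) ⟨
    A * X * (iB * iY) – A * (1# – α) * (X * (1# – ξ)) * I – r′ * c′ * (A * (1# – α) * X * I)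
      ≈⟨ +-cong (+-cong (*-congˡ (⁻¹-distrib-* B≉0 Y≉0)) (-‿cong (*-congˡ I≈)))
                (-‿cong (trans (*-congˡ (*-congˡ I≈)) (reassociate r′ c′ (A * (1# – α) * X) I))) ⟨
    A * X / (B * Y) – A * (1# – α) * (X * (1# – ξ)) / (B * (1# – β) * (Y * (1# – η)))
      – r′ * (c′ * (A * (1# – α) * X) / (B * (1# – β) * (Y * (1# – η))))  ∎
    where
    B≉0 : B ≉ 0#
    B≉0 = x*y≉0⇒x≉0 B′≉0
    β̄≉0 : 1# – β ≉ 0#
    β̄≉0 = x*y≉0⇒y≉0 B′≉0
    Y≉0 : Y ≉ 0#
    Y≉0 = x*y≉0⇒x≉0 Y′≉0
    η̄≉0 : 1# – η ≉ 0#
    η̄≉0 = x*y≉0⇒y≉0 Y′≉0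
    iB iβ̄ iY iη̄ u I : Carrier
    iB = B ⁻¹
    iβ̄ = (1# – β) ⁻¹
    iY = Y ⁻¹
    iη̄ = (1# – η) ⁻¹
    u = A * X * (iB * iY)
    I = iB * iβ̄ * (iY * iη̄)
    I≈ : (B * (1# – β) * (Y * (1# – η))) ⁻¹ ≈ I
    I≈ = trans (⁻¹-distrib-* B′≉0 Y′≉0) (*-cong (⁻¹-distrib-* B≉0 β̄≉0) (⁻¹-distrib-* Y≉0 η̄≉0))
    regroup : ∀ r c A X iB iβ̄ iY → r * (c * (A * X) * (iB * iβ̄ * iY)) ≈ r * c * iβ̄ * (A * X * (iB * iY))
    regroup = solve 7 (λ r c A X iB iβ̄ iY →
      r :* (c :* (A :* X) :* (iB :* iβ̄ :* iY)) := r :* c :* iβ̄ :* (A :* X :* (iB :* iY))) refl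
    reassociate : ∀ r c v w → r * (c * v * w) ≈ r * c * (v * w)
    reassociate = solve 4 (λ r c v w → r :* (c :* v :* w) := r :* c :* (v :* w)) refl
    difference : ∀ α β w u → (α – β) * w * u ≈ ((1# – β) * w – (1# – α) * w) * u
    difference = solve 4 (λ α β w u →
      (α :- β) :* w :* u := ((con (+ 1) :- β) :* w :- (con (+ 1) :- α) :* w) :* u) refl
    expand : ∀ α ξ η A X iB iβ̄ iY iη̄ →
      (1# – (1# – α) * iβ̄ * ((1# – η) * iη̄)) * (A * X * (iB * iY))
        ≈ A * X * (iB * iY) – A * (1# – α) * (X * (1# – ξ)) * (iB * iβ̄ * (iY * iη̄))
          – (ξ – η) * (A * (1# – α) * X * (iB * iβ̄ * (iY * iη̄)))
    expand = solve 9 (λ α ξ η A X iB iβ̄ iY iη̄ →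
      (con (+ 1) :- (con (+ 1) :- α) :* iβ̄ :* ((con (+ 1) :- η) :* iη̄)) :* (A :* X :* (iB :* iY))
        := A :* X :* (iB :* iY) :- A :* (con (+ 1) :- α) :* (X :* (con (+ 1) :- ξ)) :* (iB :* iβ̄ :* (iY :* iη̄))
          :- (ξ :- η) :* (A :* (con (+ 1) :- α) :* X :* (iB :* iβ̄ :* (iY :* iη̄)))) refl

  product : (Fin 4 → Carrier) → Carrier
  product a = a i1 * a i2 * a i3 * a i4

  product≉0 : ∀ {s} → (∀ i → s i ≉ 0#) → product s ≉ 0#
  product≉0 s≉0 = x≉0∧y≉0⇒x*y≉0 (x≉0∧y≉0⇒x*y≉0 (x≉0∧y≉0⇒x*y≉0 (s≉0 i1) (s≉0 i2)) (s≉0 i3)) (s≉0 i4)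

  powℤ-product : ∀ {s} → (∀ i → s i ≉ 0#) → ∀ e →
    powℤ (product s) e ≈ powℤ (s i1) e * powℤ (s i2) e * powℤ (s i3) e * powℤ (s i4) e
  powℤ-product {s} s≉0 e =
    trans (powℤ-distrib-* s₁s₂s₃≉0 (s≉0 i4) e)
      (*-congʳ (trans (powℤ-distrib-* s₁s₂≉0 (s≉0 i3) e)
        (*-congʳ (powℤ-distrib-* (s≉0 i1) (s≉0 i2) e))))
    where
    s₁s₂≉0 : s i1 * s i2 ≉ 0#
    s₁s₂≉0 = x≉0∧y≉0⇒x*y≉0 (s≉0 i1) (s≉0 i2)
    s₁s₂s₃≉0 : s i1 * s i2 * s i3 ≉ 0#
    s₁s₂s₃≉0 = x≉0∧y≉0⇒x*y≉0 s₁s₂≉0 (s≉0 i3)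

  -- Pᵢ stands for a power sᵢᵉ, and a₂′, P₂′ for the inverses of a₂, P₂.
  D-identity : ∀ {a₁ a₂ a₃ a₄ a₂′ P₁ P₂ P₃ P₄ P₂′} → a₂ * a₂′ ≈ 1# → P₂ * P₂′ ≈ 1# →
    a₁ * a₂′ * ((a₁ * a₂ * (P₁ * P₂) – a₃ * a₄ * (P₃ * P₄)) * (P₁ * P₂′))
      ≈ a₁ * a₁ * (P₁ * P₁) – a₁ * a₂ * a₃ * a₄ * (a₂′ * a₂′) * (P₁ * P₂ * P₃ * P₄ * (P₂′ * P₂′))
  D-identity {a₁} {a₂} {a₃} {a₄} {a₂′} {P₁} {P₂} {P₃} {P₄} {P₂′} a₂a₂′≈1 P₂P₂′≈1 = begin
    a₁ * a₂′ * ((a₁ * a₂ * (P₁ * P₂) – a₃ * a₄ * (P₃ * P₄)) * (P₁ * P₂′))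
      ≈⟨ factorˡ a₁ a₂ a₃ a₄ a₂′ P₁ P₂ P₃ P₄ P₂′ ⟩
    M₁ * w – M₂
      ≈⟨ +-congʳ (trans (*-congˡ w≈1) (*-identityʳ M₁)) ⟩
    M₁ – M₂
      ≈⟨ +-congˡ (-‿cong (trans (*-congˡ w≈1) (*-identityʳ M₂))) ⟨
    M₁ – M₂ * w
      ≈⟨ factorʳ a₁ a₂ a₃ a₄ a₂′ P₁ P₂ P₃ P₄ P₂′ ⟨
    a₁ * a₁ * (P₁ * P₁) – a₁ * a₂ * a₃ * a₄ * (a₂′ * a₂′) * (P₁ * P₂ * P₃ * P₄ * (P₂′ * P₂′))  ∎
    where
    w M₁ M₂ : Carrier
    w = a₂ * a₂′ * (P₂ * P₂′)
    w≈1 : w ≈ 1#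
    w≈1 = trans (*-cong a₂a₂′≈1 P₂P₂′≈1) (*-identityˡ 1#)
    M₁ = a₁ * a₁ * (P₁ * P₁)
    M₂ = a₁ * a₃ * a₄ * a₂′ * (P₁ * P₃ * P₄ * P₂′)
    factorˡ : ∀ a₁ a₂ a₃ a₄ a₂′ P₁ P₂ P₃ P₄ P₂′ →
      a₁ * a₂′ * ((a₁ * a₂ * (P₁ * P₂) – a₃ * a₄ * (P₃ * P₄)) * (P₁ * P₂′))
        ≈ a₁ * a₁ * (P₁ * P₁) * (a₂ * a₂′ * (P₂ * P₂′)) – a₁ * a₃ * a₄ * a₂′ * (P₁ * P₃ * P₄ * P₂′)
    factorˡ = solve 10 (λ a₁ a₂ a₃ a₄ a₂′ P₁ P₂ P₃ P₄ P₂′ →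
      a₁ :* a₂′ :* ((a₁ :* a₂ :* (P₁ :* P₂) :- a₃ :* a₄ :* (P₃ :* P₄)) :* (P₁ :* P₂′))
        := a₁ :* a₁ :* (P₁ :* P₁) :* (a₂ :* a₂′ :* (P₂ :* P₂′)) :- a₁ :* a₃ :* a₄ :* a₂′ :* (P₁ :* P₃ :* P₄ :* P₂′)) refl
    factorʳ : ∀ a₁ a₂ a₃ a₄ a₂′ P₁ P₂ P₃ P₄ P₂′ →
      a₁ * a₁ * (P₁ * P₁) – a₁ * a₂ * a₃ * a₄ * (a₂′ * a₂′) * (P₁ * P₂ * P₃ * P₄ * (P₂′ * P₂′))
        ≈ a₁ * a₁ * (P₁ * P₁) – a₁ * a₃ * a₄ * a₂′ * (P₁ * P₃ * P₄ * P₂′) * (a₂ * a₂′ * (P₂ * P₂′))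
    factorʳ = solve 10 (λ a₁ a₂ a₃ a₄ a₂′ P₁ P₂ P₃ P₄ P₂′ →
      a₁ :* a₁ :* (P₁ :* P₁) :- a₁ :* a₂ :* a₃ :* a₄ :* (a₂′ :* a₂′) :* (P₁ :* P₂ :* P₃ :* P₄ :* (P₂′ :* P₂′))
        := a₁ :* a₁ :* (P₁ :* P₁) :- a₁ :* a₃ :* a₄ :* a₂′ :* (P₁ :* P₃ :* P₄ :* P₂′) :* (a₂ :* a₂′ :* (P₂ :* P₂′))) refl

  D-coefficient-powℤ : (a s : Fin 4 → Carrier) → a i2 ≉ 0# → (∀ i → s i ≉ 0#) → ∀ e →
    a i1 / a i2 * (D a s e * powℤ (s i1 / s i2) e)
      ≈ a i1 * a i1 * powℤ (s i1 * s i1) e – product a / (a i2 * a i2) * powℤ (product s / (s i2 * s i2)) e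
  D-coefficient-powℤ a s a₂≉0 s≉0 e = begin
    a i1 * a i2 ⁻¹ * ((a i1 * a i2 * powℤ (s i1 * s i2) e – a i3 * a i4 * powℤ (s i3 * s i4) e)
                        * powℤ (s i1 * s i2 ⁻¹) e)
      ≈⟨ *-congˡ (*-cong (+-cong (*-congˡ (P-distrib i1 i2)) (-‿cong (*-congˡ (P-distrib i3 i4))))
                         (powℤ-distrib-* (s≉0 i1) s₂⁻¹≉0 e)) ⟩
    a i1 * a i2 ⁻¹ * ((a i1 * a i2 * (P i1 * P i2) – a i3 * a i4 * (P i3 * P i4)) * (P i1 * P₂′))
      ≈⟨ D-identity (inverse (a i2) a₂≉0) P₂P₂′≈1 ⟩
    a i1 * a i1 * (P i1 * P i1) – product a * (a i2 ⁻¹ * a i2 ⁻¹) * (P i1 * P i2 * P i3 * P i4 * (P₂′ * P₂′))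
      ≈⟨ +-cong (*-congˡ (P-distrib i1 i1)) (-‿cong (*-cong (*-congˡ (⁻¹-distrib-* a₂≉0 a₂≉0)) powℤ-L)) ⟨
    a i1 * a i1 * powℤ (s i1 * s i1) e – product a / (a i2 * a i2) * powℤ (product s / (s i2 * s i2)) e  ∎
    where
    P : Fin 4 → Carrier
    P i = powℤ (s i) e
    P₂′ : Carrier
    P₂′ = powℤ (s i2 ⁻¹) e
    s₂⁻¹≉0 : s i2 ⁻¹ ≉ 0#
    s₂⁻¹≉0 = x≉0⇒x⁻¹≉0 (s≉0 i2)
    P-distrib : ∀ i j → powℤ (s i * s j) e ≈ P i * P j
    P-distrib i j = powℤ-distrib-* (s≉0 i) (s≉0 j) e
    P₂P₂′≈1 : P i2 * P₂′ ≈ 1#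
    P₂P₂′≈1 = begin
      P i2 * P₂′                  ≈⟨ powℤ-distrib-* (s≉0 i2) s₂⁻¹≉0 e ⟨
      powℤ (s i2 * s i2 ⁻¹) e     ≈⟨ powℤ-cong (inverse (s i2) (s≉0 i2)) 1≉0 e ⟩
      powℤ 1# e                   ≈⟨ powℤ-1# e ⟩
      1#                          ∎
    s₂s₂≉0 : s i2 * s i2 ≉ 0#
    s₂s₂≉0 = x≉0∧y≉0⇒x*y≉0 (s≉0 i2) (s≉0 i2)
    powℤ-[s₂s₂]⁻¹ : powℤ ((s i2 * s i2) ⁻¹) e ≈ P₂′ * P₂′
    powℤ-[s₂s₂]⁻¹ = trans (powℤ-cong (⁻¹-distrib-* (s≉0 i2) (s≉0 i2)) (x≉0∧y≉0⇒x*y≉0 s₂⁻¹≉0 s₂⁻¹≉0) e)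
                      (powℤ-distrib-* s₂⁻¹≉0 s₂⁻¹≉0 e)
    powℤ-L : powℤ (product s / (s i2 * s i2)) e ≈ P i1 * P i2 * P i3 * P i4 * (P₂′ * P₂′)
    powℤ-L = begin
      powℤ (product s * (s i2 * s i2) ⁻¹) e        ≈⟨ powℤ-distrib-* (product≉0 s≉0) (x≉0⇒x⁻¹≉0 s₂s₂≉0) e ⟩
      powℤ (product s) e * powℤ ((s i2 * s i2) ⁻¹) e ≈⟨ *-cong (powℤ-product s≉0 e) powℤ-[s₂s₂]⁻¹ ⟩
      P i1 * P i2 * P i3 * P i4 * (P₂′ * P₂′)     ∎

  D-coefficient : (x t q : Fin 4 → Carrier) →
    x i2 ≉ 0# → (∀ i → q i ≉ 0#) → (∀ i → t i * t i ≈ q i) → ∀ k →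
    x i1 / x i2 * (D x t (+ k) * powℤ (t i1 / t i2) (+ k))
      ≈ x i1 * x i1 * pow (q i1) k – product x / (x i2 * x i2) * pow (product t / q i2) k
  D-coefficient x t q x₂≉0 q≉0 t²≈q k =
    trans (D-coefficient-powℤ x t x₂≉0 (λ i → x*x≈y≉0⇒x≉0 (t²≈q i) (q≉0 i)) (+ k))
      (+-cong (*-congˡ (pow-cong k (t²≈q i1)))
              (-‿cong (*-congˡ (pow-cong k (*-congˡ (⁻¹-cong (t²≈q i2) (q≉0 i2)))))))

  geometric-pred : ∀ {z c q} k → q ≉ 0# → z ≈ c * q ⁻¹ → z * pow q k ≈ c * powℤ q (+ k -ℤ + 1)
  geometric-pred {z} {c} {q} k q≉0 z≈c/q = begin
    z * pow q k               ≈⟨ *-congʳ z≈c/q ⟩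
    c * q ⁻¹ * pow q k        ≈⟨ *-assoc c (q ⁻¹) (pow q k) ⟩
    c * (q ⁻¹ * pow q k)      ≈⟨ *-congˡ (powℤ-pred q≉0 k) ⟩
    c * powℤ q (+ k -ℤ + 1)   ∎

  D-coefficient-pred : (a s p : Fin 4 → Carrier) →
    a i2 ≉ 0# → (∀ i → p i ≉ 0#) → (∀ i → s i * s i ≈ p i) → ∀ k →
    a i1 / a i2 * (D a s (+ k -ℤ + 1) * powℤ (s i1 / s i2) (+ k -ℤ + 1))
      ≈ a i1 * a i1 / p i1 * pow (p i1) k
        – product a * p i2 / (product s * (a i2 * a i2)) * pow (product s / p i2) k
  D-coefficient-pred a s p a₂≉0 p≉0 s²≈p k = begin
    a i1 / a i2 * (D a s e * powℤ (s i1 / s i2) e)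
      ≈⟨ D-coefficient-powℤ a s a₂≉0 s≉0 e ⟩
    a i1 * a i1 * powℤ (s i1 * s i1) e – K / A * powℤ (L / (s i2 * s i2)) e
      ≈⟨ +-cong (*-congˡ (powℤ-cong (s²≈p i1) (p≉0 i1) e))
                (-‿cong (*-congˡ (powℤ-cong (*-congˡ (⁻¹-cong (s²≈p i2) (p≉0 i2))) L/p₂≉0 e))) ⟩
    a i1 * a i1 * powℤ (p i1) e – K / A * powℤ (L / p i2) e
      ≈⟨ +-cong (geometric-pred k (p≉0 i1) refl) (-‿cong (geometric-pred k L/p₂≉0 β-coefficient)) ⟨
    a i1 * a i1 / p i1 * pow (p i1) k – K * p i2 / (L * A) * pow (L / p i2) k  ∎
    where
    e : ℤ
    e = + k -ℤ + 1
    K L A : Carrier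
    K = product a
    L = product s
    A = a i2 * a i2
    s≉0 : ∀ i → s i ≉ 0#
    s≉0 i = x*x≈y≉0⇒x≉0 (s²≈p i) (p≉0 i)
    L≉0 : L ≉ 0#
    L≉0 = product≉0 s≉0
    A≉0 : A ≉ 0#
    A≉0 = x≉0∧y≉0⇒x*y≉0 a₂≉0 a₂≉0
    p₂⁻¹≉0 : p i2 ⁻¹ ≉ 0#
    p₂⁻¹≉0 = x≉0⇒x⁻¹≉0 (p≉0 i2)
    L/p₂≉0 : L / p i2 ≉ 0#
    L/p₂≉0 = x≉0∧y≉0⇒x*y≉0 L≉0 p₂⁻¹≉0
    β-coefficient : K * p i2 / (L * A) ≈ K / A * (L / p i2) ⁻¹
    β-coefficient = begin
      K * p i2 * (L * A) ⁻¹          ≈⟨ *-congˡ (⁻¹-distrib-* L≉0 A≉0) ⟩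
      K * p i2 * (L ⁻¹ * A ⁻¹)       ≈⟨ swap K (p i2) (L ⁻¹) (A ⁻¹) ⟩
      K * A ⁻¹ * (L ⁻¹ * p i2)       ≈⟨ *-congˡ L/p₂⁻¹≈ ⟨
      K * A ⁻¹ * (L * p i2 ⁻¹) ⁻¹    ∎
      where
      L/p₂⁻¹≈ : (L * p i2 ⁻¹) ⁻¹ ≈ L ⁻¹ * p i2
      L/p₂⁻¹≈ = trans (⁻¹-distrib-* L≉0 p₂⁻¹≉0) (*-congˡ (⁻¹-involutive (p≉0 i2)))
      swap : ∀ K p l a → K * p * (l * a) ≈ K * a * (l * p)
      swap = solve 4 (λ K p l a → K :* p :* (l :* a) := K :* a :* (l :* p)) refl

theorem2p3 : {c ℓ : Level} (F : Field c ℓ) →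
  let open Field F
      open FieldOps F
  in (a p x q sp sq : Fin 4 → Carrier) →
     (∀ i → ¬ (a i ≈ 0#)) → (∀ i → ¬ (p i ≈ 0#)) →
     (∀ i → ¬ (x i ≈ 0#)) → (∀ i → ¬ (q i ≈ 0#)) →
     (∀ i → sp i * sp i ≈ p i) → (∀ i → sq i * sq i ≈ q i) →
     (n : ℕ) →
     let K  = a i1 * a i2 * a i3 * a i4
         L  = sp i1 * sp i2 * sp i3 * sp i4
         K₀ = x i1 * x i2 * x i3 * x i4
         L₀ = sq i1 * sq i2 * sq i3 * sq i4
         A  = λ k → poch (a i1 * a i1 / p i1) (p i1) k
         X  = λ k → poch (x i1 * x i1) (q i1) k
         B  = λ k → poch (K * p i2 / (L * (a i2 * a i2))) (L / p i2) k
         Y  = λ k → poch (K₀ / (x i2 * x i2)) (L₀ / q i2) k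
     in ¬ (B n ≈ 0#) → ¬ (Y n ≈ 0#) →
        (a i1 / a i2) *
          sumTo n (λ k → D a sp (+ k -ℤ + 1) * powℤ (sp i1 / sp i2) (+ k -ℤ + 1)
                           * (A k * X k) / (B (suc k) * Y k))
        ≈ 1# – (A n * X n) / (B n * Y n)
             – (x i1 / x i2) *
               sumTo n (λ k → D x sq (+ k) * powℤ (sq i1 / sq i2) (+ k)
                               * (A (suc k) * X k) / (B (suc k) * Y (suc k)))
theorem2p3 F a p x q sp sq a≉0 p≉0 x≉0 q≉0 sp²≈p sq²≈q n Bₙ≉0 Yₙ≉0 =
  trans (sumTo-telescope {t = T} n λ k k<n →
          pochhammer-step (D-coefficient-pred a sp p (a≉0 i2) p≉0 sp²≈p k)
                          (D-coefficient x sq q (x≉0 i2) q≉0 sq²≈q k)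
                          (poch≉0-mono (ℕ.≤⇒≤′ k<n) Bₙ≉0) (poch≉0-mono (ℕ.≤⇒≤′ k<n) Yₙ≉0))
        (+-congʳ (+-congʳ T₀≈1))
  where
  open Field F
  open FieldOps F
  open FieldProperties F
  open PochhammerTelescoping F
  A X B Y T : ℕ → Carrier
  A = poch (a i1 * a i1 / p i1) (p i1)
  X = poch (x i1 * x i1) (q i1)
  B = poch (product a * p i2 / (product sp * (a i2 * a i2))) (product sp / p i2)
  Y = poch (product x / (x i2 * x i2)) (product sq / q i2)
  T k = A k * X k / (B k * Y k)
  T₀≈1 : T 0 ≈ 1#
  T₀≈1 = inverse (1# * 1#) (x≉0∧y≉0⇒x*y≉0 1≉0 1≉0)
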